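{- For every odd positive integer $n$, the following identity of polynomials in $x$ holds: $$\sum_{r=1}^n \frac{(-1)^{r-1}x^r}{r} = \sum_{r=1}^n \binom{n}{r}\frac{(-1)^{r-1}(x+1)^r}{r} + \sum_{r=1}^n \frac{(-1)^r}{r}\binom{n}{r}.$$ -}

module Defs where

open import Data.Nat as ℕ using (ℕ; zero; suc)
open import Data.Nat.Combinatorics using (_C_)
open import Data.Integer using (+_; -[1+_])
open import Data.Rational using (ℚ; 0ℚ; 1ℚ; _+_; _*_; _/_; -_)

_^ℚ_ : ℚ → ℕ → ℚ
x ^ℚ zero  = 1ℚ
x ^ℚ suc k = x * (x ^ℚ k)

toℚ : ℕ → ℚ
toℚ m = + m / 1

-- 1 / r  for a positive natural r (r = 0 never occurs below; set to 0)
inv : ℕ → ℚ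
inv zero    = 0ℚ
inv (suc k) = + 1 / suc k

neg1^ : ℕ → ℚ
neg1^ k = (- 1ℚ) ^ℚ k

Σ[1…_] : ℕ → (ℕ → ℚ) → ℚ
Σ[1… zero  ] f = 0ℚ
Σ[1… suc n ] f = Σ[1… n ] f + f (suc n)

-- Put y = x + 1. By induction on n,
--   Σ_{r=1}^n C(n,r) (-1)^(r-1) y^r / r = Σ_{k=1}^n (1 - (1-y)^k) / k :
-- Pascal's rule peels off Σ_r C(n,r-1) (-1)^(r-1) y^r / r, which the absorption identity
-- r C(n+1,r) = (n+1) C(n,r-1) turns into (1/(n+1)) Σ_r C(n+1,r) (-1)^(r-1) y^r, and the binomial
-- theorem evaluates that to (1 - (1-y)^(n+1)) / (n+1). At y = 1 the right-hand side is the harmonic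
-- number H_n, so Σ_r (-1)^r C(n,r) / r = -H_n; at y = x + 1 the k-th term is 1/k - (-x)^k/k,
-- and subtracting H_n leaves Σ_k (-1)^(k-1) x^k / k.
module Submission where

open import Defs
open import Data.Nat.Base as ℕ using (ℕ; zero; suc; _∸_; _%_)
import Data.Nat.Properties as ℕₚ
open import Data.Nat.Combinatorics using (_C_; nC1≡n; nCk+nC[k+1]≡[n+1]C[k+1]; k>n⇒nCk≡0)
import Data.Nat.Tactic.RingSolver as ℕ-Solver
import Data.Integer.Base as ℤ
import Data.Integer.Properties as ℤₚ
open import Data.Rational.Base using (ℚ; 0ℚ; 1ℚ; _+_; _*_; _-_; -_; fromℚᵘ; toℚᵘ)
open import Data.Rational.Properties
open import Data.Rational.Unnormalised.Base as ℚᵘ using (mkℚᵘ; *≡*)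
import Data.Rational.Unnormalised.Properties as ℚᵘₚ
open import Relation.Nullary.Decidable using (dec⇒maybe)
open import Level using (0ℓ)
import Tactic.RingSolver.Core.AlmostCommutativeRing as ACR
open import Tactic.RingSolver using (solve-∀)
open import Relation.Binary.PropositionalEquality
open ≡-Reasoning

ℚ-ring : ACR.AlmostCommutativeRing 0ℓ 0ℓ
ℚ-ring = ACR.fromCommutativeRing +-*-commutativeRing (λ x → dec⇒maybe (0ℚ ≟ x))

fromℚᵘ-homo-+ : ∀ p q → fromℚᵘ (p ℚᵘ.+ q) ≡ fromℚᵘ p + fromℚᵘ q
fromℚᵘ-homo-+ p q = begin
  fromℚᵘ (p ℚᵘ.+ q)
    ≡⟨ fromℚᵘ-cong (ℚᵘₚ.+-cong (ℚᵘₚ.≃-sym (toℚᵘ-fromℚᵘ p)) (ℚᵘₚ.≃-sym (toℚᵘ-fromℚᵘ q))) ⟩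
  fromℚᵘ (toℚᵘ (fromℚᵘ p) ℚᵘ.+ toℚᵘ (fromℚᵘ q))
    ≡⟨ fromℚᵘ-cong (ℚᵘₚ.≃-sym (toℚᵘ-homo-+ (fromℚᵘ p) (fromℚᵘ q))) ⟩
  fromℚᵘ (toℚᵘ (fromℚᵘ p + fromℚᵘ q))
    ≡⟨ fromℚᵘ-toℚᵘ _ ⟩
  fromℚᵘ p + fromℚᵘ q ∎

fromℚᵘ-homo-* : ∀ p q → fromℚᵘ (p ℚᵘ.* q) ≡ fromℚᵘ p * fromℚᵘ q
fromℚᵘ-homo-* p q = begin
  fromℚᵘ (p ℚᵘ.* q)
    ≡⟨ fromℚᵘ-cong (ℚᵘₚ.*-cong (ℚᵘₚ.≃-sym (toℚᵘ-fromℚᵘ p)) (ℚᵘₚ.≃-sym (toℚᵘ-fromℚᵘ q))) ⟩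
  fromℚᵘ (toℚᵘ (fromℚᵘ p) ℚᵘ.* toℚᵘ (fromℚᵘ q))
    ≡⟨ fromℚᵘ-cong (ℚᵘₚ.≃-sym (toℚᵘ-homo-* (fromℚᵘ p) (fromℚᵘ q))) ⟩
  fromℚᵘ (toℚᵘ (fromℚᵘ p * fromℚᵘ q))
    ≡⟨ fromℚᵘ-toℚᵘ _ ⟩
  fromℚᵘ p * fromℚᵘ q ∎

-- toℚ m and inv (suc k) unfold to fromℚᵘ (m / 1) and fromℚᵘ (1 / suc k).
toℚ-+ : ∀ m n → toℚ (m ℕ.+ n) ≡ toℚ m + toℚ n
toℚ-+ m n = trans
  (fromℚᵘ-cong {mkℚᵘ (ℤ.+ (m ℕ.+ n)) 0} {mkℚᵘ (ℤ.+ m) 0 ℚᵘ.+ mkℚᵘ (ℤ.+ n) 0}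
               (*≡* (cong (ℤ._* ℤ.+ 1) numerators)))
  (fromℚᵘ-homo-+ (mkℚᵘ (ℤ.+ m) 0) (mkℚᵘ (ℤ.+ n) 0))
  where
  numerators : ℤ.+ (m ℕ.+ n) ≡ ℤ.+ m ℤ.* ℤ.+ 1 ℤ.+ ℤ.+ n ℤ.* ℤ.+ 1
  numerators = trans (ℤₚ.pos-+ m n)
                     (sym (cong₂ ℤ._+_ (ℤₚ.*-identityʳ (ℤ.+ m)) (ℤₚ.*-identityʳ (ℤ.+ n))))

toℚ-* : ∀ m n → toℚ (m ℕ.* n) ≡ toℚ m * toℚ n
toℚ-* m n = trans
  (fromℚᵘ-cong {mkℚᵘ (ℤ.+ (m ℕ.* n)) 0} {mkℚᵘ (ℤ.+ m) 0 ℚᵘ.* mkℚᵘ (ℤ.+ n) 0}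
               (*≡* (cong (ℤ._* ℤ.+ 1) (ℤₚ.pos-* m n))))
  (fromℚᵘ-homo-* (mkℚᵘ (ℤ.+ m) 0) (mkℚᵘ (ℤ.+ n) 0))

toℚ-*-inv : ∀ k → toℚ (suc k) * inv (suc k) ≡ 1ℚ
toℚ-*-inv k = trans
  (sym (fromℚᵘ-homo-* (mkℚᵘ (ℤ.+ suc k) 0) (mkℚᵘ (ℤ.+ 1) k)))
  (fromℚᵘ-cong {mkℚᵘ (ℤ.+ suc k) 0 ℚᵘ.* mkℚᵘ (ℤ.+ 1) k} {mkℚᵘ (ℤ.+ 1) 0} (*≡* cross))
  where
  cross : (ℤ.+ suc k ℤ.* ℤ.+ 1) ℤ.* ℤ.+ 1 ≡ ℤ.+ 1 ℤ.* ℤ.+ (1 ℕ.* suc k)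
  cross = trans (ℤₚ.*-identityʳ _) (trans (ℤₚ.*-identityʳ _)
            (sym (trans (ℤₚ.*-identityˡ _) (cong ℤ.+_ (ℕₚ.*-identityˡ (suc k))))))

x*[y*z]≡y*[x*z] : ∀ x y z → x * (y * z) ≡ y * (x * z)
x*[y*z]≡y*[x*z] = solve-∀ ℚ-ring

Σ-cong : ∀ n {f g : ℕ → ℚ} → (∀ k → f (suc k) ≡ g (suc k)) → Σ[1… n ] f ≡ Σ[1… n ] g
Σ-cong zero    f≗g = refl
Σ-cong (suc n) f≗g = cong₂ _+_ (Σ-cong n f≗g) (f≗g n)

Σ-distrib-+ : ∀ n (f g : ℕ → ℚ) → Σ[1… n ] (λ r → f r + g r) ≡ Σ[1… n ] f + Σ[1… n ] g
Σ-distrib-+ zero    f g = refl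
Σ-distrib-+ (suc n) f g = begin
  Σ[1… n ] (λ r → f r + g r) + (f (suc n) + g (suc n))
    ≡⟨ cong (_+ (f (suc n) + g (suc n))) (Σ-distrib-+ n f g) ⟩
  (Σ[1… n ] f + Σ[1… n ] g) + (f (suc n) + g (suc n))
    ≡⟨ interchange (Σ[1… n ] f) (Σ[1… n ] g) (f (suc n)) (g (suc n)) ⟩
  (Σ[1… n ] f + f (suc n)) + (Σ[1… n ] g + g (suc n)) ∎
  where
  interchange : ∀ a b c d → (a + b) + (c + d) ≡ (a + c) + (b + d)
  interchange = solve-∀ ℚ-ring

*-distribˡ-Σ : ∀ n c (f : ℕ → ℚ) → Σ[1… n ] (λ r → c * f r) ≡ c * Σ[1… n ] f
*-distribˡ-Σ zero    c f = sym (*-zeroʳ c)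
*-distribˡ-Σ (suc n) c f =
  trans (cong (_+ c * f (suc n)) (*-distribˡ-Σ n c f)) (sym (*-distribˡ-+ c _ _))

Σ-neg : ∀ n (f : ℕ → ℚ) → Σ[1… n ] (λ r → - f r) ≡ - Σ[1… n ] f
Σ-neg zero    f = refl
Σ-neg (suc n) f =
  trans (cong (_+ - f (suc n)) (Σ-neg n f)) (sym (neg-distrib-+ (Σ[1… n ] f) (f (suc n))))

Σ-first : ∀ n (f : ℕ → ℚ) → Σ[1… suc n ] f ≡ f 1 + Σ[1… n ] (λ r → f (suc r))
Σ-first zero    f = +-comm 0ℚ (f 1)
Σ-first (suc n) f = trans (cong (_+ f (suc (suc n))) (Σ-first n f)) (+-assoc (f 1) _ _)

1^ℚ≡1 : ∀ k → 1ℚ ^ℚ k ≡ 1ℚ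
1^ℚ≡1 zero    = refl
1^ℚ≡1 (suc k) = trans (*-identityˡ _) (1^ℚ≡1 k)

^ℚ-distrib-* : ∀ p q k → (p * q) ^ℚ k ≡ p ^ℚ k * q ^ℚ k
^ℚ-distrib-* p q zero    = refl
^ℚ-distrib-* p q (suc k) = trans (cong ((p * q) *_) (^ℚ-distrib-* p q k)) (medial p q _ _)
  where
  medial : ∀ a b c d → (a * b) * (c * d) ≡ (a * c) * (b * d)
  medial = solve-∀ ℚ-ring

[k+1]*[n+1]C[k+1]≡[n+1]*nCk : ∀ n k → suc k ℕ.* (suc n C suc k) ≡ suc n ℕ.* (n C k)
[k+1]*[n+1]C[k+1]≡[n+1]*nCk zero    zero    = refl
[k+1]*[n+1]C[k+1]≡[n+1]*nCk zero    (suc k) = ℕₚ.*-zeroʳ (suc (suc k))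
[k+1]*[n+1]C[k+1]≡[n+1]*nCk (suc n) zero    =
  trans (ℕₚ.*-identityˡ _) (trans (nC1≡n (suc (suc n))) (sym (ℕₚ.*-identityʳ _)))
[k+1]*[n+1]C[k+1]≡[n+1]*nCk (suc n) (suc k) = begin
  suc (suc k) ℕ.* (suc (suc n) C suc (suc k))
    ≡⟨ cong (suc (suc k) ℕ.*_) (sym (nCk+nC[k+1]≡[n+1]C[k+1] (suc n) (suc k))) ⟩
  suc (suc k) ℕ.* (suc n C suc k ℕ.+ suc n C suc (suc k))
    ≡⟨ split k (suc n C suc k) (suc n C suc (suc k)) ⟩
  suc n C suc k ℕ.+ suc k ℕ.* (suc n C suc k) ℕ.+ suc (suc k) ℕ.* (suc n C suc (suc k))
    ≡⟨ cong₂ (λ a b → suc n C suc k ℕ.+ a ℕ.+ b)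
             ([k+1]*[n+1]C[k+1]≡[n+1]*nCk n k) ([k+1]*[n+1]C[k+1]≡[n+1]*nCk n (suc k)) ⟩
  suc n C suc k ℕ.+ suc n ℕ.* (n C k) ℕ.+ suc n ℕ.* (n C suc k)
    ≡⟨ factor (suc n C suc k) (suc n) (n C k) (n C suc k) ⟩
  suc n C suc k ℕ.+ suc n ℕ.* (n C k ℕ.+ n C suc k)
    ≡⟨ cong (λ a → suc n C suc k ℕ.+ suc n ℕ.* a) (nCk+nC[k+1]≡[n+1]C[k+1] n k) ⟩
  suc (suc n) ℕ.* (suc n C suc k) ∎
  where
  split : ∀ k a b → suc (suc k) ℕ.* (a ℕ.+ b) ≡ a ℕ.+ suc k ℕ.* a ℕ.+ suc (suc k) ℕ.* b
  split = ℕ-Solver.solve-∀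
  factor : ∀ a m b c → a ℕ.+ m ℕ.* b ℕ.+ m ℕ.* c ≡ a ℕ.+ m ℕ.* (b ℕ.+ c)
  factor = ℕ-Solver.solve-∀

*-cross-cancel : ∀ {a b s t i j} → s * i ≡ 1ℚ → t * j ≡ 1ℚ → s * a ≡ t * b → a * j ≡ i * b
*-cross-cancel {a} {b} {s} {t} {i} {j} s*i≡1 t*j≡1 s*a≡t*b = begin
  a * j                  ≡⟨ sym (*-identityˡ (a * j)) ⟩
  1ℚ * (a * j)           ≡⟨ cong (_* (a * j)) (sym s*i≡1) ⟩
  (s * i) * (a * j)      ≡⟨ regroup s i a j ⟩
  (s * a) * (i * j)      ≡⟨ cong (_* (i * j)) s*a≡t*b ⟩
  (t * b) * (i * j)      ≡⟨ regroup′ t b i j ⟩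
  (t * j) * (i * b)      ≡⟨ cong (_* (i * b)) t*j≡1 ⟩
  1ℚ * (i * b)           ≡⟨ *-identityˡ (i * b) ⟩
  i * b                  ∎
  where
  regroup : ∀ w x y z → (w * x) * (y * z) ≡ (w * y) * (x * z)
  regroup = solve-∀ ℚ-ring
  regroup′ : ∀ w x y z → (w * x) * (y * z) ≡ (w * z) * (y * x)
  regroup′ = solve-∀ ℚ-ring

toℚ-absorption : ∀ n k → toℚ (n C k) * inv (suc k) ≡ inv (suc n) * toℚ (suc n C suc k)
toℚ-absorption n k =
  *-cross-cancel {s = toℚ (suc n)} {t = toℚ (suc k)} (toℚ-*-inv n) (toℚ-*-inv k) (begin
  toℚ (suc n) * toℚ (n C k)          ≡⟨ sym (toℚ-* (suc n) (n C k)) ⟩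
  toℚ (suc n ℕ.* (n C k))            ≡⟨ cong toℚ (sym ([k+1]*[n+1]C[k+1]≡[n+1]*nCk n k)) ⟩
  toℚ (suc k ℕ.* (suc n C suc k))    ≡⟨ toℚ-* (suc k) (suc n C suc k) ⟩
  toℚ (suc k) * toℚ (suc n C suc k)  ∎)

binomialSum : ℕ → (ℕ → ℚ) → ℚ
binomialSum n f = Σ[1… n ] (λ r → toℚ (n C r) * f r)

binomialSum-suc : ∀ n f →
  binomialSum (suc n) f ≡ binomialSum n f + Σ[1… suc n ] (λ r → toℚ (n C (r ∸ 1)) * f r)
binomialSum-suc n f = begin
  binomialSum (suc n) f
    ≡⟨ Σ-cong (suc n) pascal ⟩
  Σ[1… suc n ] (λ r → toℚ (n C r) * f r + toℚ (n C (r ∸ 1)) * f r)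
    ≡⟨ Σ-distrib-+ (suc n) (λ r → toℚ (n C r) * f r) (λ r → toℚ (n C (r ∸ 1)) * f r) ⟩
  (binomialSum n f + toℚ (n C suc n) * f (suc n)) + shifted
    ≡⟨ cong (λ c → (binomialSum n f + toℚ c * f (suc n)) + shifted) (k>n⇒nCk≡0 (ℕₚ.n<1+n n)) ⟩
  (binomialSum n f + 0ℚ * f (suc n)) + shifted
    ≡⟨ cong (λ z → (binomialSum n f + z) + shifted) (*-zeroˡ (f (suc n))) ⟩
  (binomialSum n f + 0ℚ) + shifted
    ≡⟨ cong (_+ shifted) (+-identityʳ (binomialSum n f)) ⟩
  binomialSum n f + shifted ∎
  where
  shifted : ℚ
  shifted = Σ[1… suc n ] (λ r → toℚ (n C (r ∸ 1)) * f r)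
  pascal : ∀ k → toℚ (suc n C suc k) * f (suc k)
                 ≡ toℚ (n C suc k) * f (suc k) + toℚ (n C k) * f (suc k)
  pascal k = begin
    toℚ (suc n C suc k) * f (suc k)
      ≡⟨ cong (λ c → toℚ c * f (suc k)) (sym (nCk+nC[k+1]≡[n+1]C[k+1] n k)) ⟩
    toℚ (n C k ℕ.+ n C suc k) * f (suc k)
      ≡⟨ cong (_* f (suc k)) (trans (toℚ-+ (n C k) (n C suc k))
                                    (+-comm (toℚ (n C k)) (toℚ (n C suc k)))) ⟩
    (toℚ (n C suc k) + toℚ (n C k)) * f (suc k)
      ≡⟨ *-distribʳ-+ (f (suc k)) (toℚ (n C suc k)) (toℚ (n C k)) ⟩
    toℚ (n C suc k) * f (suc k) + toℚ (n C k) * f (suc k) ∎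

*-distribˡ-binomialSum : ∀ n c f → binomialSum n (λ r → c * f r) ≡ c * binomialSum n f
*-distribˡ-binomialSum n c f =
  trans (Σ-cong n (λ k → x*[y*z]≡y*[x*z] (toℚ (n C suc k)) c (f (suc k)))) (*-distribˡ-Σ n c _)

altPow : ℚ → ℕ → ℚ
altPow y r = neg1^ (r ∸ 1) * y ^ℚ r

altPow-suc : ∀ y k → altPow y (suc (suc k)) ≡ (- y) * altPow y (suc k)
altPow-suc y k = pull-sign (neg1^ k) y (y ^ℚ suc k)
  where
  pull-sign : ∀ e y p → (- 1ℚ * e) * (y * p) ≡ (- y) * (e * p)
  pull-sign = solve-∀ ℚ-ring

binomialSum-altPow : ∀ m y → binomialSum m (altPow y) ≡ 1ℚ - (1ℚ - y) ^ℚ m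
binomialSum-altPow zero    y = refl
binomialSum-altPow (suc m) y = begin
  binomialSum (suc m) (altPow y)
    ≡⟨ binomialSum-suc m (altPow y) ⟩
  binomialSum m (altPow y) + Σ[1… suc m ] (λ r → toℚ (m C (r ∸ 1)) * altPow y r)
    ≡⟨ cong₂ _+_ (binomialSum-altPow m y) shifted ⟩
  (1ℚ - P) + (y + (- y) * (1ℚ - P))
    ≡⟨ collect y P ⟩
  1ℚ - (1ℚ - y) * P ∎
  where
  P : ℚ
  P = (1ℚ - y) ^ℚ m
  collect : ∀ y P → (1ℚ - P) + (y + (- y) * (1ℚ - P)) ≡ 1ℚ - (1ℚ - y) * P
  collect = solve-∀ ℚ-ring
  shifted : Σ[1… suc m ] (λ r → toℚ (m C (r ∸ 1)) * altPow y r) ≡ y + (- y) * (1ℚ - P)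
  shifted = begin
    Σ[1… suc m ] (λ r → toℚ (m C (r ∸ 1)) * altPow y r)
      ≡⟨ Σ-first m _ ⟩
    toℚ (m C 0) * altPow y 1 + binomialSum m (λ r → altPow y (suc r))
      ≡⟨ cong₂ _+_ (trans (*-identityˡ _) (trans (*-identityˡ _) (*-identityʳ y)))
                   (Σ-cong m (λ k → cong (toℚ (m C suc k) *_) (altPow-suc y k))) ⟩
    y + binomialSum m (λ r → (- y) * altPow y r)
      ≡⟨ cong (y +_) (*-distribˡ-binomialSum m (- y) (altPow y)) ⟩
    y + (- y) * binomialSum m (altPow y)
      ≡⟨ cong (λ z → y + (- y) * z) (binomialSum-altPow m y) ⟩
    y + (- y) * (1ℚ - P) ∎

binomialSum-altPow/r : ∀ n y →
  binomialSum n (λ r → altPow y r * inv r) ≡ Σ[1… n ] (λ k → inv k * (1ℚ - (1ℚ - y) ^ℚ k))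
binomialSum-altPow/r zero    y = refl
binomialSum-altPow/r (suc n) y = begin
  binomialSum (suc n) (λ r → altPow y r * inv r)
    ≡⟨ binomialSum-suc n (λ r → altPow y r * inv r) ⟩
  binomialSum n (λ r → altPow y r * inv r)
    + Σ[1… suc n ] (λ r → toℚ (n C (r ∸ 1)) * (altPow y r * inv r))
    ≡⟨ cong (binomialSum n (λ r → altPow y r * inv r) +_) (Σ-cong (suc n) absorb) ⟩
  binomialSum n (λ r → altPow y r * inv r) + binomialSum (suc n) (λ r → inv (suc n) * altPow y r)
    ≡⟨ cong₂ _+_ (binomialSum-altPow/r n y) (*-distribˡ-binomialSum (suc n) (inv (suc n)) (altPow y)) ⟩
  Σ[1… n ] (λ k → inv k * (1ℚ - (1ℚ - y) ^ℚ k)) + inv (suc n) * binomialSum (suc n) (altPow y)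
    ≡⟨ cong (λ z → Σ[1… n ] (λ k → inv k * (1ℚ - (1ℚ - y) ^ℚ k)) + inv (suc n) * z)
            (binomialSum-altPow (suc n) y) ⟩
  Σ[1… suc n ] (λ k → inv k * (1ℚ - (1ℚ - y) ^ℚ k)) ∎
  where
  x*[y*z]≡z*[y*x] : ∀ x y z → x * (y * z) ≡ z * (y * x)
  x*[y*z]≡z*[y*x] = solve-∀ ℚ-ring
  absorb : ∀ k → toℚ (n C k) * (altPow y (suc k) * inv (suc k))
               ≡ toℚ (suc n C suc k) * (inv (suc n) * altPow y (suc k))
  absorb k = begin
    toℚ (n C k) * (altPow y (suc k) * inv (suc k))
      ≡⟨ x*[y*z]≡y*[x*z] (toℚ (n C k)) (altPow y (suc k)) (inv (suc k)) ⟩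
    altPow y (suc k) * (toℚ (n C k) * inv (suc k))
      ≡⟨ cong (altPow y (suc k) *_) (toℚ-absorption n k) ⟩
    altPow y (suc k) * (inv (suc n) * toℚ (suc n C suc k))
      ≡⟨ x*[y*z]≡z*[y*x] (altPow y (suc k)) (inv (suc n)) (toℚ (suc n C suc k)) ⟩
    toℚ (suc n C suc k) * (inv (suc n) * altPow y (suc k)) ∎

alternating-binomial-reciprocals : ∀ n → Σ[1… n ] (λ r → neg1^ r * inv r * toℚ (n C r)) ≡ - Σ[1… n ] inv
alternating-binomial-reciprocals n = begin
  Σ[1… n ] (λ r → neg1^ r * inv r * toℚ (n C r))
    ≡⟨ Σ-cong n (λ k → trans (pull-sign (neg1^ k) (inv (suc k)) (toℚ (n C suc k)))
                             (cong (λ z → - (toℚ (n C suc k) * (neg1^ k * z * inv (suc k))))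
                                   (sym (1^ℚ≡1 (suc k))))) ⟩
  Σ[1… n ] (λ r → - (toℚ (n C r) * (altPow 1ℚ r * inv r)))
    ≡⟨ Σ-neg n _ ⟩
  - binomialSum n (λ r → altPow 1ℚ r * inv r)
    ≡⟨ cong -_ (binomialSum-altPow/r n 1ℚ) ⟩
  - Σ[1… n ] (λ k → inv k * (1ℚ - (1ℚ - 1ℚ) ^ℚ k))
    ≡⟨ cong -_ (Σ-cong n (λ k → vanish (inv (suc k)) ((1ℚ - 1ℚ) ^ℚ k))) ⟩
  - Σ[1… n ] inv ∎
  where
  pull-sign : ∀ e i c → (- 1ℚ * e) * i * c ≡ - (c * (e * 1ℚ * i))
  pull-sign = solve-∀ ℚ-ring
  vanish : ∀ i p → i * (1ℚ - (1ℚ - 1ℚ) * p) ≡ i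
  vanish = solve-∀ ℚ-ring

1-[1-[x+1]]^k/k-1/k≡altPow/k : ∀ x k →
  inv (suc k) * (1ℚ - (1ℚ - (x + 1ℚ)) ^ℚ suc k) + - inv (suc k) ≡ altPow x (suc k) * inv (suc k)
1-[1-[x+1]]^k/k-1/k≡altPow/k x k = begin
  inv (suc k) * (1ℚ - (1ℚ - (x + 1ℚ)) ^ℚ suc k) + - inv (suc k)
    ≡⟨ cong (λ z → inv (suc k) * (1ℚ - z ^ℚ suc k) + - inv (suc k)) (negate x) ⟩
  inv (suc k) * (1ℚ - (- 1ℚ * x) ^ℚ suc k) + - inv (suc k)
    ≡⟨ cong (λ z → inv (suc k) * (1ℚ - z) + - inv (suc k)) (^ℚ-distrib-* (- 1ℚ) x (suc k)) ⟩
  inv (suc k) * (1ℚ - neg1^ (suc k) * x ^ℚ suc k) + - inv (suc k)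
    ≡⟨ collect (neg1^ k) (x ^ℚ suc k) (inv (suc k)) ⟩
  altPow x (suc k) * inv (suc k) ∎
  where
  negate : ∀ x → 1ℚ - (x + 1ℚ) ≡ - 1ℚ * x
  negate = solve-∀ ℚ-ring
  collect : ∀ e p i → i * (1ℚ - (- 1ℚ * e) * p) + - i ≡ e * p * i
  collect = solve-∀ ℚ-ring

lemma2 : (n : ℕ) → n % 2 ≡ 1 → (x : ℚ) →
    Σ[1… n ] (λ r → neg1^ (r ∸ 1) * (x ^ℚ r) * inv r)
      ≡ Σ[1… n ] (λ r → toℚ (n C r) * neg1^ (r ∸ 1) * ((x + 1ℚ) ^ℚ r) * inv r)
        + Σ[1… n ] (λ r → neg1^ r * inv r * toℚ (n C r))
lemma2 n _ x = begin
  Σ[1… n ] (λ r → altPow x r * inv r)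
    ≡⟨ Σ-cong n (λ k → sym (1-[1-[x+1]]^k/k-1/k≡altPow/k x k)) ⟩
  Σ[1… n ] (λ r → inv r * (1ℚ - (1ℚ - (x + 1ℚ)) ^ℚ r) + - inv r)
    ≡⟨ Σ-distrib-+ n (λ r → inv r * (1ℚ - (1ℚ - (x + 1ℚ)) ^ℚ r)) (λ r → - inv r) ⟩
  Σ[1… n ] (λ r → inv r * (1ℚ - (1ℚ - (x + 1ℚ)) ^ℚ r)) + Σ[1… n ] (λ r → - inv r)
    ≡⟨ cong₂ _+_ (sym (binomialSum-altPow/r n (x + 1ℚ))) (Σ-neg n inv) ⟩
  binomialSum n (λ r → altPow (x + 1ℚ) r * inv r) + - Σ[1… n ] inv
    ≡⟨ cong₂ _+_ (Σ-cong n (λ k → sym (reassoc (toℚ (n C suc k)) (neg1^ k) _ (inv (suc k)))))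
                 (sym (alternating-binomial-reciprocals n)) ⟩
  Σ[1… n ] (λ r → toℚ (n C r) * neg1^ (r ∸ 1) * ((x + 1ℚ) ^ℚ r) * inv r)
    + Σ[1… n ] (λ r → neg1^ r * inv r * toℚ (n C r)) ∎
  where
  reassoc : ∀ c e p i → c * e * p * i ≡ c * (e * p * i)
  reassoc = solve-∀ ℚ-ring
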